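{- Let $v$ be a value, $\Delta$ an environment, $p\in\mathbb{N}$ and $P_1,\dots,P_p$ positive types. There is a derivation $\pi$ with conclusion $\Delta\vdash v\colon P_1\uplus\dots\uplus P_p$ if and only if for every $1\le i\le p$ there are an environment $\Delta_i$ and a derivation $\pi_i$ with conclusion $\Delta_i\vdash v\colon P_i$ such that $\Delta=\biguplus_{i=1}^p\Delta_i$. Moreover, $|\pi|=\sum_{i=1}^p|\pi_i|$.
   Context: Terms: $t ::= x \mid \lambda x.t \mid tu$ up to $\alpha$-conversion; values are variables and abstractions. Types: negative $N ::= P\multimap Q$; positive $P,Q ::= [N_1,\dots,N_n]$ finite multisets ($n\ge0$), $\mathbf{0}$ the empty multiset; $\uplus$ is multiset sum. Environments: maps from variables to positive types, $\mathbf{0}$ almost everywhere; $\uplus$ on environments is pointwise multiset sum, with neutral element the everywhere-$\mathbf{0}$ environment. Rules: (ax) $x\colon P\vdash x\colon P$; (@) from $\Gamma\vdash t\colon[P\multimap Q]$ and $\Gamma'\vdash u\colon P$ infer $\Gamma\uplus\Gamma'\vdash tu\colon Q$; ($\lambda$) for $n\ge0$, from $\Gamma_i,x\colon P_i\vdash t\colon Q_i$ ($1\le i\le n$) infer $\biguplus_i\Gamma_i\vdash\lambda x.t\colon[P_1\multimap Q_1,\dots,P_n\multimap Q_n]$. $|\pi|$ is the number of (@) rules in $\pi$. -}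

module Defs where

open import Data.Nat using (ℕ; zero; suc; _+_)
open import Data.Fin using (Fin; zero; suc)
open import Data.List using (List; []; _∷_; _++_; [_])
open import Data.List.Relation.Binary.Permutation.Homogeneous using (Permutation)
open import Relation.Nullary using (Dec; yes; no)
open import Data.Nat using (_≟_)

-- Terms of the pure λ-calculus, up to α-conversion: de Bruijn indices.

data Term : Set where
  var : ℕ → Term
  lam : Term → Term
  app : Term → Term → Term

data IsValue : Term → Set where
  var-val : ∀ x → IsValue (var x)
  lam-val : ∀ t → IsValue (lam t)

-- Types.  Positive types are finite multisets of negative types,
-- represented by lists and compared up to permutation (recursively,
-- up to equality of the elements).

data Neg : Set where
  _⊸_ : List Neg → List Neg → Neg

Pos : Set
Pos = List Neg

𝟎 : Pos
𝟎 = []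

_⊎ᵖ_ : Pos → Pos → Pos
_⊎ᵖ_ = _++_

mutual
  data _≈ⁿ_ : Neg → Neg → Set where
    ⊸-cong : ∀ {P P′ Q Q′} → P ≈ᵖ P′ → Q ≈ᵖ Q′ → (P ⊸ Q) ≈ⁿ (P′ ⊸ Q′)

  data _≈ᵖ_ : Pos → Pos → Set where
    perm : ∀ {P Q} → Permutation _≈ⁿ_ P Q → P ≈ᵖ Q

Env : Set
Env = ℕ → Pos

∅ᴱ : Env
∅ᴱ _ = 𝟎

_⊎ᴱ_ : Env → Env → Env
(Γ ⊎ᴱ Γ′) x = Γ x ⊎ᵖ Γ′ x

_≈ᴱ_ : Env → Env → Set
Γ ≈ᴱ Γ′ = ∀ x → Γ x ≈ᵖ Γ′ x

_↦_ : ℕ → Pos → Env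
(x ↦ P) y with x ≟ y
... | yes _ = P
... | no  _ = 𝟎

-- Γ , x : P where x is the newly bound de Bruijn variable 0
_∷ᴱ_ : Pos → Env → Env
(P ∷ᴱ Γ) zero    = P
(P ∷ᴱ Γ) (suc x) = Γ x

⨄ᵖ : ∀ {p} → (Fin p → Pos) → Pos
⨄ᵖ {zero}  P = 𝟎
⨄ᵖ {suc p} P = P zero ⊎ᵖ ⨄ᵖ (λ i → P (suc i))

⨄ᴱ : ∀ {p} → (Fin p → Env) → Env
⨄ᴱ {zero}  Γ = ∅ᴱ
⨄ᴱ {suc p} Γ = Γ zero ⊎ᴱ ⨄ᴱ (λ i → Γ (suc i))

Σℕ : ∀ {p} → (Fin p → ℕ) → ℕ
Σℕ {zero}  f = 0
Σℕ {suc p} f = f zero + Σℕ (λ i → f (suc i))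

arrows : ∀ {n} → (Fin n → Pos) → (Fin n → Pos) → Pos
arrows {zero}  P Q = []
arrows {suc n} P Q = (P zero ⊸ Q zero) ∷ arrows (λ i → P (suc i)) (λ i → Q (suc i))

-- Since types and environments are multisets
-- (quotients), every rule is stated up to ≈ on the types/environments
-- of its conclusion and its matching conditions; this is exactly
-- the system on the quotient, and it does not change the number of
-- (@) rules.

infix 4 _⊢_∶_

data _⊢_∶_ : Env → Term → Pos → Set where
  ax  : ∀ {Γ x P} → Γ ≈ᴱ (x ↦ P) → Γ ⊢ var x ∶ P
  app : ∀ {Γ Γ′ Δ t u R P Q} →
        Γ ⊢ t ∶ R → R ≈ᵖ [ P ⊸ Q ] → Γ′ ⊢ u ∶ P → Δ ≈ᴱ (Γ ⊎ᴱ Γ′) →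
        Δ ⊢ app t u ∶ Q
  lam : ∀ {Δ t R} (n : ℕ) (Γ : Fin n → Env) (P Q : Fin n → Pos) →
        ((i : Fin n) → (P i ∷ᴱ Γ i) ⊢ t ∶ Q i) →
        R ≈ᵖ arrows P Q → Δ ≈ᴱ ⨄ᴱ Γ →
        Δ ⊢ lam t ∶ R

size : ∀ {Γ t P} → Γ ⊢ t ∶ P → ℕ
size (ax _)              = 0
size (app π _ π′ _)      = suc (size π + size π′)
size (lam n Γ P Q πs _ _) = Σℕ (λ i → size (πs i))

-- A value is typed without (@) at its root: a variable by one axiom, whose
-- environment x : P is additive in P, and an abstraction by one (λ) rule whose
-- premises ("branches") each contribute one arrow to the type and their
-- environments and sizes additively.  So a derivation of an abstraction is the
-- same thing as a list of branches, taken up to permutation; splitting a sum type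
-- means sorting its branches, and merging derivations means concatenating branch
-- lists.  Both directions for P₁ ⊎ … ⊎ Pₚ follow from the cases p = 0 and p = 2
-- by induction.
module Submission where

open import Defs
open import Data.Empty using (⊥-elim)
open import Data.Fin using (Fin; zero; suc)
open import Data.List using (List; []; _∷_; _++_; map; tabulate; lookup)
open import Data.List.Properties using (map-++; tabulate-lookup)
open import Data.List.Relation.Binary.Pointwise.Base using (Pointwise; []; _∷_)
import Data.List.Relation.Binary.Pointwise.Properties as Pointwise
open import Data.List.Relation.Binary.Permutation.Homogeneous as Homogeneous
  using (Permutation)
open import Data.List.Relation.Binary.Permutation.Propositional as ↭
  using (_↭_; ↭-refl; ↭-reflexive; ↭-prep; ↭-swap; ↭-trans)
import Data.List.Relation.Binary.Permutation.Propositional.Properties as ↭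
import Data.List.Relation.Binary.Permutation.Setoid as Setoid↭
import Data.List.Relation.Binary.Permutation.Setoid.Properties as Setoid↭ₚ
open import Data.Nat using (ℕ; zero; suc; _+_; _≟_)
open import Data.Nat.ListAction using (sum)
open import Data.Nat.ListAction.Properties using (sum-++; sum-↭)
open import Data.Product using (Σ; ∃; ∃₂; _×_; _,_)
open import Function using (_∘_)
open import Level using (0ℓ)
open import Relation.Binary.Bundles using (Setoid)
open import Relation.Binary.Core using (Rel)
open import Relation.Binary.Definitions using (Reflexive; Symmetric; Transitive)
open import Relation.Binary.PropositionalEquality
  using (_≡_; refl; sym; trans; cong; cong₂; module ≡-Reasoning)
open import Relation.Nullary using (yes; no)

mutual
  ≈ⁿ-refl : Reflexive _≈ⁿ_
  ≈ⁿ-refl {P ⊸ Q} = ⊸-cong ≈ᵖ-refl ≈ᵖ-refl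

  ≈ᵖ-refl : Reflexive _≈ᵖ_
  ≈ᵖ-refl = perm (Homogeneous.refl ≈ⁿ-pointwise-refl)

  ≈ⁿ-pointwise-refl : Reflexive (Pointwise _≈ⁿ_)
  ≈ⁿ-pointwise-refl {[]}    = []
  ≈ⁿ-pointwise-refl {N ∷ P} = ≈ⁿ-refl ∷ ≈ⁿ-pointwise-refl

mutual
  ≈ⁿ-sym : Symmetric _≈ⁿ_
  ≈ⁿ-sym (⊸-cong p q) = ⊸-cong (≈ᵖ-sym p) (≈ᵖ-sym q)

  ≈ᵖ-sym : Symmetric _≈ᵖ_
  ≈ᵖ-sym (perm σ) = perm (≈ⁿ-permutation-sym σ)

  ≈ⁿ-permutation-sym : Symmetric (Permutation _≈ⁿ_)
  ≈ⁿ-permutation-sym (Homogeneous.refl ps)    = Homogeneous.refl (≈ⁿ-pointwise-sym ps)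
  ≈ⁿ-permutation-sym (Homogeneous.prep e σ)   = Homogeneous.prep (≈ⁿ-sym e) (≈ⁿ-permutation-sym σ)
  ≈ⁿ-permutation-sym (Homogeneous.swap e f σ) =
    Homogeneous.swap (≈ⁿ-sym f) (≈ⁿ-sym e) (≈ⁿ-permutation-sym σ)
  ≈ⁿ-permutation-sym (Homogeneous.trans σ τ)  =
    Homogeneous.trans (≈ⁿ-permutation-sym τ) (≈ⁿ-permutation-sym σ)

  ≈ⁿ-pointwise-sym : Symmetric (Pointwise _≈ⁿ_)
  ≈ⁿ-pointwise-sym []       = []
  ≈ⁿ-pointwise-sym (e ∷ es) = ≈ⁿ-sym e ∷ ≈ⁿ-pointwise-sym es

≈ᵖ-trans : Transitive _≈ᵖ_
≈ᵖ-trans (perm σ) (perm τ) = perm (Homogeneous.trans σ τ)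

≈ⁿ-trans : Transitive _≈ⁿ_
≈ⁿ-trans (⊸-cong p q) (⊸-cong p′ q′) = ⊸-cong (≈ᵖ-trans p p′) (≈ᵖ-trans q q′)

≈ⁿ-setoid : Setoid 0ℓ 0ℓ
≈ⁿ-setoid = record
  { _≈_           = _≈ⁿ_
  ; isEquivalence = record { refl = ≈ⁿ-refl ; sym = ≈ⁿ-sym ; trans = ≈ⁿ-trans }
  }

open Setoid↭ ≈ⁿ-setoid using (↭-sym)
open Setoid↭ₚ ≈ⁿ-setoid using (++⁺; ++-assoc; shifts; ¬x∷xs↭[])

≈ᵖ-reflexive : ∀ {P Q} → P ≡ Q → P ≈ᵖ Q
≈ᵖ-reflexive refl = ≈ᵖ-refl

⊎ᵖ-cong : ∀ {P P′ Q Q′} → P ≈ᵖ P′ → Q ≈ᵖ Q′ → (P ⊎ᵖ Q) ≈ᵖ (P′ ⊎ᵖ Q′)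
⊎ᵖ-cong (perm σ) (perm τ) = perm (++⁺ σ τ)

≈ᴱ-setoid : Setoid 0ℓ 0ℓ
≈ᴱ-setoid = record
  { _≈_           = _≈ᴱ_
  ; isEquivalence = record
    { refl  = λ _ → ≈ᵖ-refl
    ; sym   = λ e x → ≈ᵖ-sym (e x)
    ; trans = λ e f x → ≈ᵖ-trans (e x) (f x)
    }
  }

module ≈ᴱ = Setoid ≈ᴱ-setoid

⊎ᴱ-cong : ∀ {Γ Γ′ Δ Δ′} → Γ ≈ᴱ Γ′ → Δ ≈ᴱ Δ′ → (Γ ⊎ᴱ Δ) ≈ᴱ (Γ′ ⊎ᴱ Δ′)
⊎ᴱ-cong e f x = ⊎ᵖ-cong (e x) (f x)

⊎ᴱ-congˡ : ∀ Γ {Δ Δ′} → Δ ≈ᴱ Δ′ → (Γ ⊎ᴱ Δ) ≈ᴱ (Γ ⊎ᴱ Δ′)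
⊎ᴱ-congˡ Γ = ⊎ᴱ-cong {Γ} ≈ᴱ.refl

⊎ᴱ-assoc : ∀ Γ Δ Θ → ((Γ ⊎ᴱ Δ) ⊎ᴱ Θ) ≈ᴱ (Γ ⊎ᴱ (Δ ⊎ᴱ Θ))
⊎ᴱ-assoc Γ Δ Θ x = perm (++-assoc (Γ x) (Δ x) (Θ x))

⊎ᴱ-left-comm : ∀ Γ Δ Θ → (Γ ⊎ᴱ (Δ ⊎ᴱ Θ)) ≈ᴱ (Δ ⊎ᴱ (Γ ⊎ᴱ Θ))
⊎ᴱ-left-comm Γ Δ Θ x = perm (shifts (Γ x) (Δ x))

↦-𝟎 : ∀ x → (x ↦ 𝟎) ≈ᴱ ∅ᴱ
↦-𝟎 x y with x ≟ y
... | yes _ = ≈ᵖ-refl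
... | no  _ = ≈ᵖ-refl

↦-⊎ᵖ : ∀ x P Q → (x ↦ (P ⊎ᵖ Q)) ≈ᴱ ((x ↦ P) ⊎ᴱ (x ↦ Q))
↦-⊎ᵖ x P Q y with x ≟ y
... | yes _ = ≈ᵖ-refl
... | no  _ = ≈ᵖ-refl

module _ {a b ℓ} {A : Set a} {B : Set b} {_≈_ : Rel B ℓ} (f : A → B) where

  Permutation-map⁻ : Transitive _≈_ → ∀ {ys zs xs} →
                     Permutation _≈_ ys zs → Pointwise _≈_ zs (map f xs) →
                     ∃ λ xs′ → xs ↭ xs′ × Pointwise _≈_ ys (map f xs′)
  Permutation-map⁻ ≈-trans {xs = xs} (Homogeneous.refl ps) qs =
    xs , ↭-refl , Pointwise.transitive ≈-trans ps qs
  Permutation-map⁻ ≈-trans {xs = x ∷ xs} (Homogeneous.prep e σ) (e′ ∷ qs) =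
    let xs′ , τ , ps = Permutation-map⁻ ≈-trans σ qs
    in x ∷ xs′ , ↭-prep x τ , ≈-trans e e′ ∷ ps
  Permutation-map⁻ ≈-trans {xs = x ∷ y ∷ xs} (Homogeneous.swap e₁ e₂ σ) (e₁′ ∷ e₂′ ∷ qs) =
    let xs′ , τ , ps = Permutation-map⁻ ≈-trans σ qs
    in y ∷ x ∷ xs′ , ↭-swap x y τ , ≈-trans e₁ e₂′ ∷ ≈-trans e₂ e₁′ ∷ ps
  Permutation-map⁻ ≈-trans (Homogeneous.trans σ τ) qs =
    let xs′  , ρ  , ps  = Permutation-map⁻ ≈-trans τ qs
        xs″ , ρ′ , ps′ = Permutation-map⁻ ≈-trans σ ps
    in xs″ , ↭-trans ρ ρ′ , ps′

  Pointwise-++-map⁻ : ∀ ys {zs} xs → Pointwise _≈_ (ys ++ zs) (map f xs) →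
                      ∃₂ λ xs₁ xs₂ → xs ≡ xs₁ ++ xs₂ ×
                        Pointwise _≈_ ys (map f xs₁) × Pointwise _≈_ zs (map f xs₂)
  Pointwise-++-map⁻ []       xs       ps       = [] , xs , refl , [] , ps
  Pointwise-++-map⁻ (y ∷ ys) (x ∷ xs) (p ∷ ps) =
    let xs₁ , xs₂ , eq , ps₁ , ps₂ = Pointwise-++-map⁻ ys xs ps
    in x ∷ xs₁ , xs₂ , cong (x ∷_) eq , p ∷ ps₁ , ps₂

module _ {a} {A : Set a} (f : A → Neg) where

  map-𝟎⁻ : ∀ xs → 𝟎 ≈ᵖ map f xs → xs ≡ []
  map-𝟎⁻ []       _        = refl
  map-𝟎⁻ (x ∷ xs) (perm σ) = ⊥-elim (¬x∷xs↭[] (↭-sym σ))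

  map-⊎ᵖ⁻ : ∀ P Q xs → (P ⊎ᵖ Q) ≈ᵖ map f xs →
            ∃₂ λ xs₁ xs₂ → xs ↭ xs₁ ++ xs₂ × P ≈ᵖ map f xs₁ × Q ≈ᵖ map f xs₂
  map-⊎ᵖ⁻ P Q xs (perm σ) =
    let xs′ , τ , ps                = Permutation-map⁻ f ≈ⁿ-trans σ ≈ⁿ-pointwise-refl
        xs₁ , xs₂ , eq , ps₁ , ps₂ = Pointwise-++-map⁻ f P xs′ ps
    in xs₁ , xs₂ , ↭-trans τ (↭-reflexive eq) ,
       perm (Homogeneous.refl ps₁) , perm (Homogeneous.refl ps₂)

record Branch (t : Term) : Set where
  constructor branch
  field
    {ctx}     : Env
    {dom cod} : Pos
    premise   : (dom ∷ᴱ ctx) ⊢ t ∶ cod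

open Branch

module _ {t : Term} where

  arrowᴮ : Branch t → Neg
  arrowᴮ b = dom b ⊸ cod b

  arrowsᴸ : List (Branch t) → Pos
  arrowsᴸ = map arrowᴮ

  envᴸ : List (Branch t) → Env
  envᴸ []      = ∅ᴱ
  envᴸ (b ∷ L) = ctx b ⊎ᴱ envᴸ L

  sizeᴸ : List (Branch t) → ℕ
  sizeᴸ = sum ∘ map (size ∘ premise)

  envᴸ-++ : ∀ L₁ L₂ → envᴸ (L₁ ++ L₂) ≈ᴱ (envᴸ L₁ ⊎ᴱ envᴸ L₂)
  envᴸ-++ []       L₂ = ≈ᴱ.refl
  envᴸ-++ (b ∷ L₁) L₂ = ≈ᴱ.trans (⊎ᴱ-congˡ (ctx b) (envᴸ-++ L₁ L₂))
                                  (≈ᴱ.sym (⊎ᴱ-assoc (ctx b) (envᴸ L₁) (envᴸ L₂)))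

  envᴸ-↭ : ∀ {L L′} → L ↭ L′ → envᴸ L ≈ᴱ envᴸ L′
  envᴸ-↭ ↭.refl                   = ≈ᴱ.refl
  envᴸ-↭ (↭.prep b σ)             = ⊎ᴱ-congˡ (ctx b) (envᴸ-↭ σ)
  envᴸ-↭ (↭.swap {xs = L} b c σ) =
    ≈ᴱ.trans (⊎ᴱ-left-comm (ctx b) (ctx c) (envᴸ L))
             (⊎ᴱ-congˡ (ctx c) (⊎ᴱ-congˡ (ctx b) (envᴸ-↭ σ)))
  envᴸ-↭ (↭.trans σ τ)            = ≈ᴱ.trans (envᴸ-↭ σ) (envᴸ-↭ τ)

  sizeᴸ-++ : ∀ L₁ L₂ → sizeᴸ (L₁ ++ L₂) ≡ sizeᴸ L₁ + sizeᴸ L₂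
  sizeᴸ-++ L₁ L₂ = trans (cong sum (map-++ (size ∘ premise) L₁ L₂))
                         (sum-++ (map (size ∘ premise) L₁) (map (size ∘ premise) L₂))

  sizeᴸ-↭ : ∀ {L L′} → L ↭ L′ → sizeᴸ L ≡ sizeᴸ L′
  sizeᴸ-↭ σ = sum-↭ (↭.map⁺ (size ∘ premise) σ)

  arrowsᴸ-tabulate : ∀ {n} (b : Fin n → Branch t) →
                     arrowsᴸ (tabulate b) ≡ arrows (dom ∘ b) (cod ∘ b)
  arrowsᴸ-tabulate {zero}  b = refl
  arrowsᴸ-tabulate {suc n} b = cong (arrowᴮ (b zero) ∷_) (arrowsᴸ-tabulate (b ∘ suc))

  envᴸ-tabulate : ∀ {n} (b : Fin n → Branch t) → envᴸ (tabulate b) ≡ ⨄ᴱ (ctx ∘ b)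
  envᴸ-tabulate {zero}  b = refl
  envᴸ-tabulate {suc n} b = cong (ctx (b zero) ⊎ᴱ_) (envᴸ-tabulate (b ∘ suc))

  sizeᴸ-tabulate : ∀ {n} (b : Fin n → Branch t) →
                   sizeᴸ (tabulate b) ≡ Σℕ (size ∘ premise ∘ b)
  sizeᴸ-tabulate {zero}  b = refl
  sizeᴸ-tabulate {suc n} b = cong (size (premise (b zero)) +_) (sizeᴸ-tabulate (b ∘ suc))

  decompose : ∀ {Δ R} (π : Δ ⊢ lam t ∶ R) →
              Σ (List (Branch t)) λ L → R ≈ᵖ arrowsᴸ L × Δ ≈ᴱ envᴸ L × size π ≡ sizeᴸ L
  decompose (lam n Γ P Q πs eR eΔ) =
    tabulate b ,
    ≈ᵖ-trans eR (≈ᵖ-reflexive (sym (arrowsᴸ-tabulate b))) ,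
    ≈ᴱ.trans eΔ (≈ᴱ.reflexive (sym (envᴸ-tabulate b))) ,
    sym (sizeᴸ-tabulate b)
    where
      b : Fin n → Branch t
      b i = branch (πs i)

  compose : ∀ {Δ R} L → R ≈ᵖ arrowsᴸ L → Δ ≈ᴱ envᴸ L →
            Σ (Δ ⊢ lam t ∶ R) λ π → size π ≡ sizeᴸ L
  compose L eR eΔ =
    lam _ (ctx ∘ b) (dom ∘ b) (cod ∘ b) (premise ∘ b)
      (≈ᵖ-trans eR (≈ᵖ-reflexive (trans (cong arrowsᴸ L≡) (arrowsᴸ-tabulate b))))
      (≈ᴱ.trans eΔ (≈ᴱ.reflexive (trans (cong envᴸ L≡) (envᴸ-tabulate b)))) ,
    sym (trans (cong sizeᴸ L≡) (sizeᴸ-tabulate b))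
    where
      b = lookup L
      L≡ = sym (tabulate-lookup L)

record Split (v : Term) (Δ : Env) (P Q : Pos) (n : ℕ) : Set where
  field
    {Δ₁ Δ₂} : Env
    left    : Δ₁ ⊢ v ∶ P
    right   : Δ₂ ⊢ v ∶ Q
    env≈    : Δ ≈ᴱ (Δ₁ ⊎ᴱ Δ₂)
    size≡   : n ≡ size left + size right

record Additive (v : Term) : Set where
  field
    split₀ : ∀ {Δ} (π : Δ ⊢ v ∶ 𝟎) → Δ ≈ᴱ ∅ᴱ × size π ≡ 0
    merge₀ : ∀ {Δ} → Δ ≈ᴱ ∅ᴱ → Σ (Δ ⊢ v ∶ 𝟎) λ π → size π ≡ 0
    split₂ : ∀ {Δ P Q} (π : Δ ⊢ v ∶ P ⊎ᵖ Q) → Split v Δ P Q (size π)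
    merge₂ : ∀ {Δ P Q n} → Split v Δ P Q n → Σ (Δ ⊢ v ∶ P ⊎ᵖ Q) λ π → size π ≡ n

var-additive : ∀ x → Additive (var x)
var-additive x = record
  { split₀ = λ { (ax e) → ≈ᴱ.trans e (↦-𝟎 x) , refl }
  ; merge₀ = λ e → ax (≈ᴱ.trans e (≈ᴱ.sym (↦-𝟎 x))) , refl
  ; split₂ = λ { {P = P} {Q} (ax e) → record
      { left  = ax ≈ᴱ.refl
      ; right = ax ≈ᴱ.refl
      ; env≈  = ≈ᴱ.trans e (↦-⊎ᵖ x P Q)
      ; size≡ = refl
      } }
  ; merge₂ = λ { {P = P} {Q} record { left = ax e₁ ; right = ax e₂ ; env≈ = e ; size≡ = refl } →
      ax (≈ᴱ.trans e (≈ᴱ.trans (⊎ᴱ-cong e₁ e₂) (≈ᴱ.sym (↦-⊎ᵖ x P Q)))) , refl }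
  }

lam-additive : ∀ t → Additive (lam t)
lam-additive t = record
  { split₀ = split₀
  ; merge₀ = compose [] ≈ᵖ-refl
  ; split₂ = split₂
  ; merge₂ = merge₂
  }
  where
    split₀ : ∀ {Δ} (π : Δ ⊢ lam t ∶ 𝟎) → Δ ≈ᴱ ∅ᴱ × size π ≡ 0
    split₀ π with decompose π
    ... | L , eR , eΔ , s with map-𝟎⁻ arrowᴮ L eR
    ... | refl = eΔ , s

    split₂ : ∀ {Δ P Q} (π : Δ ⊢ lam t ∶ P ⊎ᵖ Q) → Split (lam t) Δ P Q (size π)
    split₂ {P = P} {Q} π =
      let L , eR , eΔ , s = decompose π
          L₁ , L₂ , σ , e₁ , e₂ = map-⊎ᵖ⁻ arrowᴮ P Q L eR
          π₁ , s₁ = compose L₁ e₁ ≈ᴱ.refl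
          π₂ , s₂ = compose L₂ e₂ ≈ᴱ.refl
      in record
        { left  = π₁
        ; right = π₂
        ; env≈  = ≈ᴱ.trans eΔ (≈ᴱ.trans (envᴸ-↭ σ) (envᴸ-++ L₁ L₂))
        ; size≡ = begin
            size π                ≡⟨ s ⟩
            sizeᴸ L               ≡⟨ sizeᴸ-↭ σ ⟩
            sizeᴸ (L₁ ++ L₂)      ≡⟨ sizeᴸ-++ L₁ L₂ ⟩
            sizeᴸ L₁ + sizeᴸ L₂   ≡⟨ cong₂ _+_ (sym s₁) (sym s₂) ⟩
            size π₁ + size π₂     ∎
        }
      where open ≡-Reasoning

    merge₂ : ∀ {Δ P Q n} → Split (lam t) Δ P Q n →
             Σ (Δ ⊢ lam t ∶ P ⊎ᵖ Q) λ π → size π ≡ n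
    merge₂ record { left = π₁ ; right = π₂ ; env≈ = e ; size≡ = s } =
      let L₁ , eR₁ , eΔ₁ , s₁ = decompose π₁
          L₂ , eR₂ , eΔ₂ , s₂ = decompose π₂
          π , sπ = compose (L₁ ++ L₂)
            (≈ᵖ-trans (⊎ᵖ-cong eR₁ eR₂) (≈ᵖ-reflexive (sym (map-++ arrowᴮ L₁ L₂))))
            (≈ᴱ.trans e (≈ᴱ.trans (⊎ᴱ-cong eΔ₁ eΔ₂) (≈ᴱ.sym (envᴸ-++ L₁ L₂))))
      in π , trans sπ (trans (sizeᴸ-++ L₁ L₂) (sym (trans s (cong₂ _+_ s₁ s₂))))

value-additive : ∀ {v} → IsValue v → Additive v
value-additive (var-val x) = var-additive x
value-additive (lam-val t) = lam-additive t

module _ {v : Term} (additive : Additive v) where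
  open Additive additive

  ⨄-split : ∀ {Δ} p (P : Fin p → Pos) (π : Δ ⊢ v ∶ ⨄ᵖ P) →
            Σ (Fin p → Env) (λ Δs →
              Σ ((i : Fin p) → Δs i ⊢ v ∶ P i) (λ πs →
                (Δ ≈ᴱ ⨄ᴱ Δs) × (size π ≡ Σℕ (λ i → size (πs i)))))
  ⨄-split zero    P π = let e , s = split₀ π in (λ ()) , (λ ()) , e , s
  ⨄-split (suc p) P π =
    let record { Δ₁ = Δ₁ ; left = π₁ ; right = π₂ ; env≈ = e ; size≡ = s } = split₂ π
        Δs , πs , e′ , s′ = ⨄-split p (P ∘ suc) π₂
    in (λ { zero → Δ₁ ; (suc i) → Δs i }) ,
       (λ { zero → π₁ ; (suc i) → πs i }) ,
       ≈ᴱ.trans e (⊎ᴱ-congˡ _ e′) ,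
       trans s (cong (size π₁ +_) s′)

  ⨄-merge : ∀ {Δ} p (P : Fin p → Pos) (Δs : Fin p → Env) →
            (πs : (i : Fin p) → Δs i ⊢ v ∶ P i) → Δ ≈ᴱ ⨄ᴱ Δs →
            Σ (Δ ⊢ v ∶ ⨄ᵖ P) (λ π → size π ≡ Σℕ (λ i → size (πs i)))
  ⨄-merge zero    P Δs πs e = merge₀ e
  ⨄-merge (suc p) P Δs πs e =
    let π₂ , s₂ = ⨄-merge p (P ∘ suc) (Δs ∘ suc) (πs ∘ suc) ≈ᴱ.refl
    in merge₂ record
      { left  = πs zero
      ; right = π₂
      ; env≈  = e
      ; size≡ = cong (size (πs zero) +_) (sym s₂)
      }

lemma3p2 : (v : Term) → IsValue v → (Δ : Env) (p : ℕ) (P : Fin p → Pos) →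
    ((π : Δ ⊢ v ∶ ⨄ᵖ P) →
      Σ (Fin p → Env) (λ Δs →
        Σ ((i : Fin p) → Δs i ⊢ v ∶ P i) (λ πs →
          (Δ ≈ᴱ ⨄ᴱ Δs) × (size π ≡ Σℕ (λ i → size (πs i))))))
  × ((Δs : Fin p → Env) → (πs : (i : Fin p) → Δs i ⊢ v ∶ P i) → Δ ≈ᴱ ⨄ᴱ Δs →
      Σ (Δ ⊢ v ∶ ⨄ᵖ P) (λ π → size π ≡ Σℕ (λ i → size (πs i))))
lemma3p2 v v-val Δ p P =
  ⨄-split (value-additive v-val) p P , ⨄-merge (value-additive v-val) p P
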